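{- Let $n$ be even and let $A$ be an abelian group of order $n$ that is not elementary abelian. Let $G=D(A)=\langle x,A\mid x^2=1,\ xax=a^{ -1}\ \forall a\in A\rangle$ act on the $n$ left cosets of $H=\langle x\rangle$, so $G\le\mathrm{Sym}(n)$, and suppose that every element of $A$ acts as an even permutation. Then $\alpha(\Gamma_G)=2$ and there is an inverse-closed $D\subseteq\mathrm{Der}(G)$ such that $\alpha(\mathrm{Cay}(G,\mathrm{Der}(G)\setminus D))=3$.
   Context: A derangement is an element fixing no coset; $\mathrm{Der}(G)$ is the set of derangements. For inverse-closed $S\subseteq G$ not containing the identity, $\mathrm{Cay}(G,S)$ is the graph on $G$ with $g,h$ adjacent iff $g^{ -1}h\in S$; $\Gamma_G=\mathrm{Cay}(G,\mathrm{Der}(G))$; $\alpha$ denotes independence number. -}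

module Defs where

open import Data.Nat using (ℕ; zero; suc; _<_; _≤_)
open import Data.Nat.Primality using (Prime)
open import Data.Nat.Divisibility using (_∣_)
open import Data.Fin using (Fin; toℕ)
open import Data.Bool using (Bool; true; false; if_then_else_; _xor_)
open import Data.Product using (_×_; _,_; proj₁; Σ; ∃)
open import Data.Sum using (_⊎_)
open import Data.List using (List; length; filter; allFin; cartesianProduct)
open import Data.List.Relation.Unary.AllPairs using (AllPairs)
open import Relation.Binary.PropositionalEquality using (_≡_; _≢_)
open import Relation.Nullary using (¬_)
open import Relation.Nullary.Decidable using (_×-dec_)
open import Relation.Unary using (Pred)
import Data.Nat as ℕ
open import Level using (0ℓ)

inversions : ∀ {n} → (Fin n → Fin n) → ℕ
inversions {n} σ =
  length (filter (λ p → (toℕ (proj₁ p) ℕ.<? toℕ (Data.Product.proj₂ p))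
                        ×-dec (toℕ (σ (Data.Product.proj₂ p)) ℕ.<? toℕ (σ (proj₁ p))))
                 (cartesianProduct (allFin n) (allFin n)))

EvenPerm : ∀ {n} → (Fin n → Fin n) → Set
EvenPerm σ = 2 ∣ inversions σ

module _ {n : ℕ} (_∙_ : Fin n → Fin n → Fin n) (ε : Fin n) where
  pow : Fin n → ℕ → Fin n
  pow a zero = ε
  pow a (suc k) = a ∙ pow a k

  ElementaryAbelian : Set
  ElementaryAbelian = Σ ℕ λ p → Prime p × (∀ a → pow a p ≡ ε)

-- The generalized dihedral group D(A) = A ⋊ ⟨x⟩, for A with carrier Fin n.
-- The element (a , s) stands for a x^s (s = true meaning x is present).
module Dihedral {n : ℕ} (_∙_ : Fin n → Fin n → Fin n) (ε : Fin n)
                (_⁻¹ : Fin n → Fin n) where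

  D : Set
  D = Fin n × Bool

  -- (a x^s)(c x^t) = a (x^s c x^s) x^(s+t), with x c x = c⁻¹
  _*_ : D → D → D
  (a , s) * (c , t) = (a ∙ (if s then c ⁻¹ else c)) , (s xor t)

  one : D
  one = ε , false

  x : D
  x = ε , true

  inv : D → D
  inv (a , false) = (a ⁻¹) , false
  inv (a , true) = a , true

  ι : Fin n → D
  ι a = a , false

  InH : D → Set
  InH g = (g ≡ one) ⊎ (g ≡ x)

  -- g fixes the left coset cH  iff  g c H = c H  iff  c⁻¹ g c ∈ H
  FixesCoset : D → D → Set
  FixesCoset g c = InH ((inv c * g) * c)

  Der : Pred D 0ℓ
  Der g = ∀ c → ¬ FixesCoset g c

  -- The permutation induced by g on the n left cosets of H, where the
  -- coset aH (a ∈ A) is labelled by a ∈ Fin n (every coset has exactly one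
  -- such representative, since (a x^s)H = aH).
  cosetPerm : D → Fin n → Fin n
  cosetPerm g a = proj₁ (g * ι a)

  -- Cayley graph Cay(D, S): g ~ h iff g⁻¹h ∈ S.
  -- Independent set: list of pairwise distinct, pairwise non-adjacent vertices.
  Independent : Pred D 0ℓ → List D → Set
  Independent S L = AllPairs (λ g h → g ≢ h × ¬ S (inv g * h) × ¬ S (inv h * g)) L

  IndependenceNumber : Pred D 0ℓ → ℕ → Set
  IndependenceNumber S k =
    (Σ (List D) λ L → Independent S L × length L ≡ k)
    × (∀ L → Independent S L → length L ≤ k)

  InverseClosed : Pred D 0ℓ → Set
  InverseClosed S = ∀ g → S g → S (inv g)

  _⊆_ : Pred D 0ℓ → Pred D 0ℓ → Set
  S ⊆ T = ∀ g → S g → T g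

  _∖_ : Pred D 0ℓ → Pred D 0ℓ → Pred D 0ℓ
  (S ∖ T) g = S g × ¬ T g

-- Distinct elements of one coset of A in D(A) differ by a non-identity element of A,
-- which fixes no coset of ⟨x⟩; so an independent set of Γ has at most one rotation and one
-- reflection, and α(Γ) = 2. A reflection b x is a derangement exactly when b is not a square.
-- Translation by g ∈ A is the product of the involutions c ↦ g c⁻¹ and c ↦ c⁻¹, and an
-- involution of an n-set with f fixed points has sign (-1)^((n - f)/2); the fixed points are the
-- square roots of g and of 1. Taking g a non-square, evenness of the translations forces the
-- number of square roots of 1 to be divisible by 4, so at most a quarter of A are squares. This
-- gives a non-square a of order > 2 (A is not elementary abelian) and an element c such that
-- c and c a are both non-squares. After removing {a, a⁻¹, c x, c a x}, the set {1, a, c a x} is independent, and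
-- sorting four vertices by coset shows that no independent set has four elements.
module Submission where

open import Data.Nat using (ℕ; zero; suc; _+_; _*_; _≤_; _<_; z≤n; s≤s; ⌊_/2⌋; >-nonZero)
import Data.Nat as ℕ
open import Data.Nat.Properties
open import Data.Nat.Primality using (prime?)
open import Data.Nat.Divisibility
  using (_∣_; divides; ∣m∣n⇒∣m+n; ∣m+n∣m⇒∣n; ∣n⇒∣m*n; n∣m*n; ∣⇒≤)
open import Data.Nat.Solver using (module +-*-Solver)
open import Data.Fin using (Fin; zero; suc; toℕ) renaming (_≟_ to _≟ᶠ_)
import Data.Fin.Properties as Finₚ
open import Data.Fin.Permutation using (permutation)
open import Data.List using (List; []; _∷_; length; filter; map; tabulate; _++_; cartesianProduct; allFin)
open import Data.List.Properties using (map-tabulate)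
open import Data.Bool using (true; false; if_then_else_)
open import Data.Sum using (_⊎_; inj₁; inj₂; [_,_]′)
open import Data.Product using (_×_; _,_; proj₁; proj₂; ∃; Σ; map₂)
open import Data.Product.Properties using (≡-dec)
import Data.Bool.Properties as Boolₚ
open import Data.Empty using (⊥; ⊥-elim)
open import Data.List.Relation.Unary.All using ([]; _∷_)
open import Data.List.Relation.Unary.AllPairs using ([]; _∷_)
open import Data.Vec.Functional using (replicate)
open import Function using (_∘_; id; flip)
open import Relation.Binary using (tri<; tri≈; tri>)
open import Relation.Binary.PropositionalEquality
  using (_≡_; _≢_; refl; sym; trans; cong; cong₂; subst; module ≡-Reasoning)
open import Relation.Nullary using (Dec; yes; no; ¬_; does; contradiction)
open import Relation.Nullary.Decidable using (_×-dec_; _⊎-dec_; from-yes)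
open import Relation.Unary using (Pred; Decidable)
open import Algebra.Properties.CommutativeMonoid.Sum +-0-commutativeMonoid
  using (sum; sum-syntax; sum-cong-≗; ∑-comm; ∑-distrib-+; sum-permute; sum-replicate-zero)
open import Algebra.Properties.Semiring.Sum +-*-semiring using (*-distribʳ-sum)
open import Algebra.Bundles using (AbelianGroup)
open import Algebra.Core using (Op₁; Op₂)
open import Algebra.Structures using (IsAbelianGroup)
open import Level using (0ℓ)
open import Defs

open +-*-Solver

Even : ℕ → Set
Even k = 2 ∣ k

Even-double : ∀ k → Even (k + k)
Even-double k = divides k (solve 1 (λ k → k :+ k := k :* con 2) refl k)

Even-r+x+x : ∀ {r x} → Even (r + x + x) → Even r
Even-r+x+x {r} {x} even =
  ∣m+n∣m⇒∣n (subst Even (solve 2 (λ r x → r :+ x :+ x := x :+ x :+ r) refl r x) even) (Even-double x)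

Even-cancel : ∀ {t a b x y} → Even t → Even (t + a + b) → Even (a + x) → Even (b + y) → Even (x + y)
Even-cancel {t} {a} {b} {x} {y} even-t even-tab even-ax even-by = ∣m+n∣m⇒∣n
  (subst Even (solve 5 (λ t a b x y → t :+ a :+ b :+ (a :+ x) :+ (b :+ y)
                                     := t :+ (a :+ b :+ (a :+ b)) :+ (x :+ y)) refl t a b x y)
         (∣m∣n⇒∣m+n (∣m∣n⇒∣m+n even-tab even-ax) even-by))
  (∣m∣n⇒∣m+n even-t (Even-double (a + b)))

4≤-from-parity : ∀ {r x y} → r + x + x ≡ y + y → Even (x + y) → 1 ≤ r → 4 ≤ r
4≤-from-parity {r} {x} {y} balance (divides k x+y≡k*2) 1≤r = ∣⇒≤ ⦃ >-nonZero 1≤r ⦄ (∣m+n∣m⇒∣n (divides k (begin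
  x * 4 + r             ≡⟨ solve 2 (λ r x → x :* con 4 :+ r := r :+ x :+ x :+ (x :+ x)) refl r x ⟩
  r + x + x + (x + x)   ≡⟨ cong (_+ (x + x)) balance ⟩
  y + y + (x + x)       ≡⟨ solve 2 (λ x y → y :+ y :+ (x :+ x) := x :+ y :+ (x :+ y)) refl x y ⟩
  x + y + (x + y)       ≡⟨ cong (λ s → s + s) x+y≡k*2 ⟩
  k * 2 + k * 2         ≡⟨ solve 1 (λ k → k :* con 2 :+ k :* con 2 := k :* con 4) refl k ⟩
  k * 4                 ∎)) (n∣m*n x))
  where open ≡-Reasoning

k+k<k*4 : ∀ {k} → 1 ≤ k → k + k < k * 4
k+k<k*4 {k} 1≤k = ≤-trans (m<m+n (k + k) (≤-trans 1≤k (m≤m+n k k)))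
                          (≤-reflexive (solve 1 (λ k → k :+ k :+ (k :+ k) := k :* con 4) refl k))

𝟙 : ∀ {p} {P : Set p} → Dec P → ℕ
𝟙 P? = if does P? then 1 else 0

module _ {p} {P : Set p} where

  𝟙-yes : (P? : Dec P) → P → 𝟙 P? ≡ 1
  𝟙-yes (yes _) _ = refl
  𝟙-yes (no ¬p) p = contradiction p ¬p

  𝟙-no : (P? : Dec P) → ¬ P → 𝟙 P? ≡ 0
  𝟙-no (yes p) ¬p = contradiction p ¬p
  𝟙-no (no _)  _  = refl

  𝟙-idem : (P? : Dec P) → 𝟙 P? * 𝟙 P? ≡ 𝟙 P?
  𝟙-idem (yes _) = refl
  𝟙-idem (no _)  = refl

module _ {p q} {P : Set p} {Q : Set q} where

  1≤𝟙+𝟙 : (P? : Dec P) (Q? : Dec Q) → P ⊎ Q → 1 ≤ 𝟙 P? + 𝟙 Q?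
  1≤𝟙+𝟙 P? Q? (inj₁ p) = ≤-trans (≤-reflexive (sym (𝟙-yes P? p))) (m≤m+n (𝟙 P?) (𝟙 Q?))
  1≤𝟙+𝟙 P? Q? (inj₂ q) = ≤-trans (≤-reflexive (sym (𝟙-yes Q? q))) (m≤n+m (𝟙 Q?) (𝟙 P?))

  𝟙-cong : (P? : Dec P) (Q? : Dec Q) → (P → Q) → (Q → P) → 𝟙 P? ≡ 𝟙 Q?
  𝟙-cong P? Q? f g with P? | Q?
  ... | yes _ | yes _ = refl
  ... | no  _ | no  _ = refl
  ... | yes p | no ¬q = contradiction (f p) ¬q
  ... | no ¬p | yes q = contradiction (g q) ¬p

  𝟙-× : (P? : Dec P) (Q? : Dec Q) → 𝟙 (P? ×-dec Q?) ≡ 𝟙 P? * 𝟙 Q?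
  𝟙-× (yes _) (yes _) = refl
  𝟙-× (yes _) (no _)  = refl
  𝟙-× (no _)  _       = refl

module _ {a p} {A : Set a} {P : Pred A p} (P? : Decidable P) where

  length-filter-++ : ∀ (xs ys : List A) →
    length (filter P? (xs ++ ys)) ≡ length (filter P? xs) + length (filter P? ys)
  length-filter-++ []       ys = refl
  length-filter-++ (x ∷ xs) ys with does (P? x)
  ... | true  = cong suc (length-filter-++ xs ys)
  ... | false = length-filter-++ xs ys

  length-filter-tabulate : ∀ {m} (f : Fin m → A) →
    length (filter P? (tabulate f)) ≡ ∑[ i < m ] 𝟙 (P? (f i))
  length-filter-tabulate {zero}  f = refl
  length-filter-tabulate {suc m} f with P? (f zero)
  ... | yes _ = cong suc (length-filter-tabulate (f ∘ suc))
  ... | no  _ = length-filter-tabulate (f ∘ suc)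

module _ {b c p} {B : Set b} {C : Set c} {P : Pred (B × C) p} (P? : Decidable P) where

  length-filter-cartesianProduct : ∀ {m} (f : Fin m → B) (ys : List C) →
    length (filter P? (cartesianProduct (tabulate f) ys))
      ≡ ∑[ i < m ] length (filter P? (map (f i ,_) ys))
  length-filter-cartesianProduct {zero}  f ys = refl
  length-filter-cartesianProduct {suc m} f ys =
    trans (length-filter-++ P? (map (f zero ,_) ys) _)
          (cong (length (filter P? (map (f zero ,_) ys)) +_) (length-filter-cartesianProduct (f ∘ suc) ys))

∑-ones : ∀ m → ∑[ i < m ] 1 ≡ m
∑-ones zero    = refl
∑-ones (suc m) = cong suc (∑-ones m)

∑-zero : ∀ {m} {f : Fin m → ℕ} → (∀ i → f i ≡ 0) → sum f ≡ 0
∑-zero {m} f≡0 = trans (sum-cong-≗ f≡0) (sum-replicate-zero m)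

∑-mono-≤ : ∀ {m} {f g : Fin m → ℕ} → (∀ i → f i ≤ g i) → sum f ≤ sum g
∑-mono-≤ {zero}  _   = z≤n
∑-mono-≤ {suc m} f≤g = +-mono-≤ (f≤g zero) (∑-mono-≤ (f≤g ∘ suc))

term≤∑ : ∀ {m} (f : Fin m → ℕ) i → f i ≤ sum f
term≤∑ f zero    = m≤m+n (f zero) _
term≤∑ f (suc i) = ≤-trans (term≤∑ (f ∘ suc) i) (m≤n+m _ (f zero))

∑-δ : ∀ {m} (k : Fin m) (f : Fin m → ℕ) → ∑[ i < m ] (𝟙 (i ≟ᶠ k) * f i) ≡ f k
∑-δ {suc m} zero    f = trans (cong₂ _+_ (*-identityˡ (f zero)) (sum-replicate-zero m)) (+-identityʳ (f zero))
∑-δ {suc m} (suc k) f = ∑-δ k (f ∘ suc)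

∑-reindex : ∀ {m} {π π⁻¹ : Fin m → Fin m} →
  (∀ i → π (π⁻¹ i) ≡ i) → (∀ i → π⁻¹ (π i) ≡ i) →
  (f : Fin m → ℕ) → ∑[ i < m ] f (π i) ≡ sum f
∑-reindex {π = π} {π⁻¹} inverseˡ inverseʳ f = sym (sum-permute f (permutation π π⁻¹ inverseˡ inverseʳ))

∑-distrib-+₃ : ∀ {m} (f g h : Fin m → ℕ) →
  ∑[ i < m ] (f i + g i + h i) ≡ sum f + sum g + sum h
∑-distrib-+₃ f g h = trans (∑-distrib-+ (λ i → f i + g i) h) (cong (_+ sum h) (∑-distrib-+ f g))

∑-𝟙≟ : ∀ {m} (k : Fin m) → ∑[ i < m ] 𝟙 (i ≟ᶠ k) ≡ 1
∑-𝟙≟ {m} k = trans (sum-cong-≗ (λ i → sym (*-identityʳ (𝟙 (i ≟ᶠ k))))) (∑-δ k (λ _ → 1))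

Even-∑ : ∀ {m} {f : Fin m → ℕ} → (∀ i → Even (f i)) → Even (sum f)
Even-∑ {zero}  _     = divides 0 refl
Even-∑ {suc m} evens = ∣m∣n⇒∣m+n (evens zero) (Even-∑ (evens ∘ suc))

-- Inversions and the parity of permutations

module _ {m : ℕ} where

  _<ᶠ?_ : (a b : Fin m) → Dec (toℕ a < toℕ b)
  a <ᶠ? b = toℕ a ℕ.<? toℕ b

  [_<_] : Fin m → Fin m → ℕ
  [ a < b ] = 𝟙 (a <ᶠ? b)

  [<]-irrefl : ∀ a → [ a < a ] ≡ 0
  [<]-irrefl a = 𝟙-no (a <ᶠ? a) (<-irrefl refl)

  data Order (a b : Fin m) : Set where
    less    : [ a < b ] ≡ 1 → [ b < a ] ≡ 0 → a ≢ b → Order a b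
    equal   : a ≡ b → Order a b
    greater : [ a < b ] ≡ 0 → [ b < a ] ≡ 1 → a ≢ b → Order a b

  order : ∀ a b → Order a b
  order a b with Finₚ.<-cmp a b
  ... | tri< a<b a≢b b≮a = less (𝟙-yes (a <ᶠ? b) a<b) (𝟙-no (b <ᶠ? a) b≮a) a≢b
  ... | tri≈ _   a≡b _   = equal a≡b
  ... | tri> a≮b a≢b b<a = greater (𝟙-no (a <ᶠ? b) a≮b) (𝟙-yes (b <ᶠ? a) b<a) a≢b

  [<]-trichotomy : ∀ a b → 𝟙 (a ≟ᶠ b) + [ a < b ] + [ b < a ] ≡ 1
  [<]-trichotomy a b with order a b
  ... | less    a<b b≮a a≢b rewrite a<b | b≮a | 𝟙-no (a ≟ᶠ b) a≢b = refl
  ... | greater a≮b b<a a≢b rewrite a≮b | b<a | 𝟙-no (a ≟ᶠ b) a≢b = refl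
  ... | equal refl rewrite [<]-irrefl a | 𝟙-yes (a ≟ᶠ a) refl = refl

  [<]-connex : ∀ {a b} → a ≢ b → [ a < b ] + [ b < a ] ≡ 1
  [<]-connex {a} {b} a≢b = trans (cong (λ k → k + [ a < b ] + [ b < a ]) (sym (𝟙-no (a ≟ᶠ b) a≢b)))
                                 ([<]-trichotomy a b)

  ∑₂ : (Fin m → Fin m → ℕ) → ℕ
  ∑₂ f = ∑[ i < m ] ∑[ j < m ] f i j

  ∑₂-cong : ∀ {f g : Fin m → Fin m → ℕ} → (∀ i j → f i j ≡ g i j) → ∑₂ f ≡ ∑₂ g
  ∑₂-cong f≡g = sum-cong-≗ (λ i → sum-cong-≗ (f≡g i))

  ∑₂-distrib-+ : ∀ (f g : Fin m → Fin m → ℕ) → ∑₂ (λ i j → f i j + g i j) ≡ ∑₂ f + ∑₂ g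
  ∑₂-distrib-+ f g = trans (sum-cong-≗ (λ i → ∑-distrib-+ (f i) (g i))) (∑-distrib-+ (sum ∘ f) (sum ∘ g))

  ∑₂-distrib-+₃ : ∀ (f g h : Fin m → Fin m → ℕ) →
    ∑₂ (λ i j → f i j + g i j + h i j) ≡ ∑₂ f + ∑₂ g + ∑₂ h
  ∑₂-distrib-+₃ f g h =
    trans (sum-cong-≗ (λ i → ∑-distrib-+₃ (f i) (g i) (h i))) (∑-distrib-+₃ (sum ∘ f) (sum ∘ g) (sum ∘ h))

  ∑₂-transpose : ∀ (f : Fin m → Fin m → ℕ) → ∑₂ f ≡ ∑₂ (λ i j → f j i)
  ∑₂-transpose = ∑-comm

  ∑₂-reindex : ∀ {π π⁻¹ : Fin m → Fin m} →
    (∀ i → π (π⁻¹ i) ≡ i) → (∀ i → π⁻¹ (π i) ≡ i) →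
    (f : Fin m → Fin m → ℕ) → ∑₂ (λ i j → f (π i) (π j)) ≡ ∑₂ f
  ∑₂-reindex {π} inverseˡ inverseʳ f =
    trans (sum-cong-≗ (λ i → ∑-reindex {π = π} inverseˡ inverseʳ (f (π i))))
          (∑-reindex {π = π} inverseˡ inverseʳ (sum ∘ f))

  ∑₂-symmetric : ∀ (G : Fin m → Fin m → ℕ) → (∀ i j → G i j ≡ G j i) → (∀ i → G i i ≡ 0) →
    ∑₂ G ≡ ∑₂ (λ i j → [ i < j ] * G i j) + ∑₂ (λ i j → [ i < j ] * G i j)
  ∑₂-symmetric G G-sym G-diag = begin
    ∑₂ G                                                           ≡⟨ ∑₂-cong split ⟩
    ∑₂ (λ i j → [ i < j ] * G i j + [ j < i ] * G i j)             ≡⟨ ∑₂-distrib-+ _ _ ⟩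
    ∑₂ (λ i j → [ i < j ] * G i j) + ∑₂ (λ i j → [ j < i ] * G i j) ≡⟨ cong (∑₂ (λ i j → [ i < j ] * G i j) +_) swap ⟩
    ∑₂ (λ i j → [ i < j ] * G i j) + ∑₂ (λ i j → [ i < j ] * G i j) ∎
    where
    open ≡-Reasoning
    split : ∀ i j → G i j ≡ [ i < j ] * G i j + [ j < i ] * G i j
    split i j with order i j
    ... | less    i<j j≮i _ rewrite i<j | j≮i = solve 1 (λ g → g := con 1 :* g :+ con 0 :* g) refl (G i j)
    ... | greater i≮j j<i _ rewrite i≮j | j<i = solve 1 (λ g → g := con 0 :* g :+ con 1 :* g) refl (G i j)
    ... | equal refl rewrite G-diag i = sym (cong₂ _+_ (*-zeroʳ [ i < i ]) (*-zeroʳ [ i < i ]))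
    swap : ∑₂ (λ i j → [ j < i ] * G i j) ≡ ∑₂ (λ i j → [ i < j ] * G i j)
    swap = trans (∑₂-transpose _) (∑₂-cong (λ i j → cong ([ i < j ] *_) (G-sym j i)))

  ∑-pairs-reindex : ∀ {π π⁻¹ : Fin m → Fin m} →
    (∀ i → π (π⁻¹ i) ≡ i) → (∀ i → π⁻¹ (π i) ≡ i) →
    (G : Fin m → Fin m → ℕ) → (∀ i j → G i j ≡ G j i) → (∀ i → G i i ≡ 0) →
    ∑₂ (λ i j → [ i < j ] * G (π i) (π j)) ≡ ∑₂ (λ i j → [ i < j ] * G i j)
  ∑-pairs-reindex {π} inverseˡ inverseʳ G G-sym G-diag = +-cancel-double (begin
    P∘π + P∘π                  ≡⟨ ∑₂-symmetric (λ i j → G (π i) (π j)) (λ i j → G-sym (π i) (π j)) (G-diag ∘ π) ⟨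
    ∑₂ (λ i j → G (π i) (π j)) ≡⟨ ∑₂-reindex {π = π} inverseˡ inverseʳ G ⟩
    ∑₂ G                       ≡⟨ ∑₂-symmetric G G-sym G-diag ⟩
    P + P                      ∎)
    where
    open ≡-Reasoning
    P∘π = ∑₂ (λ i j → [ i < j ] * G (π i) (π j))
    P   = ∑₂ (λ i j → [ i < j ] * G i j)
    +-cancel-double : ∀ {x y} → x + x ≡ y + y → x ≡ y
    +-cancel-double {x} {y} eq = trans (n≡⌊n+n/2⌋ x) (trans (cong ⌊_/2⌋ eq) (sym (n≡⌊n+n/2⌋ y)))

  Even-[<]* : ∀ i j {w} → (i ≢ j → Even w) → Even ([ i < j ] * w)
  Even-[<]* i j even-w with order i j
  ... | equal refl rewrite [<]-irrefl i = divides 0 refl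
  ... | less    _ _ i≢j = ∣n⇒∣m*n [ i < j ] (even-w i≢j)
  ... | greater _ _ i≢j = ∣n⇒∣m*n [ i < j ] (even-w i≢j)

  inverted : (Fin m → Fin m) → Fin m → Fin m → ℕ
  inverted σ i j = [ i < j ] * [ σ j < σ i ]

  inversionCount : (Fin m → Fin m) → ℕ
  inversionCount σ = ∑₂ (inverted σ)

  inversionCount-cong : ∀ {σ τ} → (∀ i → σ i ≡ τ i) → inversionCount σ ≡ inversionCount τ
  inversionCount-cong σ≗τ = ∑₂-cong λ i j → cong₂ (λ p q → [ i < j ] * [ p < q ]) (σ≗τ j) (σ≗τ i)

  inversions≡inversionCount : ∀ σ → inversions σ ≡ inversionCount σ
  inversions≡inversionCount σ =
    trans (length-filter-cartesianProduct P? id (allFin m)) (sum-cong-≗ λ i →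
      trans (cong (length ∘ filter P?) (map-tabulate id (i ,_)))
        (trans (length-filter-tabulate P? (i ,_))
               (sum-cong-≗ λ j → 𝟙-× (i <ᶠ? j) (σ j <ᶠ? σ i))))
    where
    P? = λ (p : Fin m × Fin m) → (proj₁ p <ᶠ? proj₂ p) ×-dec (σ (proj₂ p) <ᶠ? σ (proj₁ p))

  crossing : (Fin m → Fin m) → Fin m → Fin m → ℕ
  crossing σ a b = [ a < b ] * [ σ b < σ a ] + [ b < a ] * [ σ a < σ b ]

  crossing-sym : ∀ σ a b → crossing σ a b ≡ crossing σ b a
  crossing-sym σ a b = +-comm ([ a < b ] * [ σ b < σ a ]) _

  crossing-diag : ∀ σ a → crossing σ a a ≡ 0
  crossing-diag σ a rewrite [<]-irrefl a = refl

  inversionCount≡∑-crossing : ∀ σ → inversionCount σ ≡ ∑₂ (λ i j → [ i < j ] * crossing σ i j)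
  inversionCount≡∑-crossing σ = ∑₂-cong pointwise
    where
    pointwise : ∀ i j → [ i < j ] * [ σ j < σ i ] ≡ [ i < j ] * crossing σ i j
    pointwise i j with order i j
    ... | less i<j j≮i _ rewrite i<j | j≮i =
      solve 2 (λ x y → con 1 :* x := con 1 :* (con 1 :* x :+ con 0 :* y)) refl [ σ j < σ i ] [ σ i < σ j ]
    ... | greater i≮j _ _ rewrite i≮j = refl
    ... | equal refl rewrite [<]-irrefl i = refl

  crossing-parity : ∀ σ → (∀ {a b} → σ a ≡ σ b → a ≡ b) → ∀ {a b} → a ≢ b →
    Even ([ σ b < σ a ] + [ b < a ] + crossing σ a b)
  crossing-parity σ σ-injective {a} {b} a≢b with order a b
  ... | equal a≡b = contradiction a≡b a≢b
  ... | less a<b b≮a _ rewrite a<b | b≮a =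
    subst Even (solve 2 (λ x y → x :+ x := x :+ con 0 :+ (con 1 :* x :+ con 0 :* y)) refl
                        [ σ b < σ a ] [ σ a < σ b ])
               (Even-double [ σ b < σ a ])
  ... | greater a≮b b<a _ rewrite a≮b | b<a =
    subst Even (trans (cong suc (sym ([<]-connex (a≢b ∘ σ-injective ∘ sym))))
                      (solve 2 (λ x y → con 1 :+ (x :+ y) := x :+ con 1 :+ (con 0 :* y :+ con 1 :* y)) refl
                             [ σ b < σ a ] [ σ a < σ b ]))
               (divides 1 refl)

  inversionCount-∘ : ∀ (σ π π⁻¹ : Fin m → Fin m) → (∀ {a b} → σ a ≡ σ b → a ≡ b) →
    (∀ i → π (π⁻¹ i) ≡ i) → (∀ i → π⁻¹ (π i) ≡ i) →
    Even (inversionCount (σ ∘ π) + inversionCount π + inversionCount σ)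
  inversionCount-∘ σ π π⁻¹ σ-injective inverseˡ inverseʳ =
    subst Even total (Even-∑ λ i → Even-∑ λ j → Even-[<]* i j λ i≢j →
      crossing-parity σ σ-injective (i≢j ∘ π-injective))
    where
    open ≡-Reasoning
    π-injective : ∀ {i j} → π i ≡ π j → i ≡ j
    π-injective {i} {j} πi≡πj = trans (sym (inverseʳ i)) (trans (cong π⁻¹ πi≡πj) (inverseʳ j))
    total : ∑₂ (λ i j → [ i < j ] * ([ σ (π j) < σ (π i) ] + [ π j < π i ] + crossing σ (π i) (π j)))
          ≡ inversionCount (σ ∘ π) + inversionCount π + inversionCount σ
    total = begin
      ∑₂ (λ i j → [ i < j ] * ([ σ (π j) < σ (π i) ] + [ π j < π i ] + crossing σ (π i) (π j)))
        ≡⟨ ∑₂-cong (λ i j → solve 4 (λ l x y z → l :* (x :+ y :+ z) := l :* x :+ l :* y :+ l :* z) refl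
                                    [ i < j ] [ σ (π j) < σ (π i) ] [ π j < π i ] (crossing σ (π i) (π j))) ⟩
      ∑₂ (λ i j → [ i < j ] * [ σ (π j) < σ (π i) ] + [ i < j ] * [ π j < π i ]
                  + [ i < j ] * crossing σ (π i) (π j))
        ≡⟨ ∑₂-distrib-+₃ _ _ _ ⟩
      inversionCount (σ ∘ π) + inversionCount π + ∑₂ (λ i j → [ i < j ] * crossing σ (π i) (π j))
        ≡⟨ cong (inversionCount (σ ∘ π) + inversionCount π +_)
                (∑-pairs-reindex {π = π} inverseˡ inverseʳ (crossing σ) (crossing-sym σ) (crossing-diag σ)) ⟩
      inversionCount (σ ∘ π) + inversionCount π + ∑₂ (λ i j → [ i < j ] * crossing σ i j)
        ≡⟨ cong (inversionCount (σ ∘ π) + inversionCount π +_) (inversionCount≡∑-crossing σ) ⟨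
      inversionCount (σ ∘ π) + inversionCount π + inversionCount σ ∎

  fixedPoints : (Fin m → Fin m) → ℕ
  fixedPoints ρ = ∑[ j < m ] 𝟙 (ρ j ≟ᶠ j)

  drops : (Fin m → Fin m) → ℕ
  drops ρ = ∑[ j < m ] [ ρ j < j ]

  module _ (ρ : Fin m → Fin m) (ρ-involutive : ∀ i → ρ (ρ i) ≡ i) where

    fixedPoints+drops+drops : fixedPoints ρ + drops ρ + drops ρ ≡ m
    fixedPoints+drops+drops = begin
      fixedPoints ρ + drops ρ + drops ρ
        ≡⟨ cong (fixedPoints ρ + drops ρ +_) rises≡drops ⟨
      fixedPoints ρ + drops ρ + ∑[ j < m ] [ j < ρ j ]
        ≡⟨ ∑-distrib-+₃ (λ j → 𝟙 (ρ j ≟ᶠ j)) (λ j → [ ρ j < j ]) (λ j → [ j < ρ j ]) ⟨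
      ∑[ j < m ] (𝟙 (ρ j ≟ᶠ j) + [ ρ j < j ] + [ j < ρ j ])
        ≡⟨ sum-cong-≗ (λ j → [<]-trichotomy (ρ j) j) ⟩
      ∑[ j < m ] 1
        ≡⟨ ∑-ones m ⟩
      m ∎
      where
      open ≡-Reasoning
      rises≡drops : ∑[ j < m ] [ j < ρ j ] ≡ drops ρ
      rises≡drops = trans (sum-cong-≗ (λ j → cong [_< ρ j ] (sym (ρ-involutive j))))
                          (∑-reindex {π = ρ} ρ-involutive ρ-involutive (λ j → [ ρ j < j ]))

    inverted-on-graph : ∑₂ (λ i j → inverted ρ i j * 𝟙 (i ≟ᶠ ρ j)) ≡ drops ρ
    inverted-on-graph = trans (∑₂-cong on-graph)
      (trans (∑₂-transpose _) (sum-cong-≗ λ j → ∑-δ (ρ j) (λ _ → [ ρ j < j ])))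
      where
      on-graph : ∀ i j → inverted ρ i j * 𝟙 (i ≟ᶠ ρ j) ≡ 𝟙 (i ≟ᶠ ρ j) * [ ρ j < j ]
      on-graph i j with i ≟ᶠ ρ j
      ... | no  _    = *-zeroʳ (inverted ρ i j)
      ... | yes refl rewrite ρ-involutive j =
        trans (*-identityʳ _) (trans (𝟙-idem (ρ j <ᶠ? j)) (sym (+-identityʳ _)))

    -- (i , j) ↦ (ρ j , ρ i) exchanges the inversions lying below and above the graph of ρ.
    inverted-below≡above : ∑₂ (λ i j → inverted ρ i j * [ ρ j < i ]) ≡ ∑₂ (λ i j → inverted ρ i j * [ i < ρ j ])
    inverted-below≡above =
      trans (sym (trans (∑₂-transpose _) (∑₂-reindex {π = ρ} ρ-involutive ρ-involutive _))) (∑₂-cong swapped)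
      where
      swapped : ∀ i j → inverted ρ (ρ j) (ρ i) * [ ρ (ρ i) < ρ j ] ≡ inverted ρ i j * [ i < ρ j ]
      swapped i j rewrite ρ-involutive i | ρ-involutive j =
        cong (_* [ i < ρ j ]) (*-comm [ ρ j < ρ i ] [ i < j ])

    inversionCount-involution : Even (inversionCount ρ + drops ρ)
    inversionCount-involution = subst Even (sym decomposition) (Even-double (drops ρ + above))
      where
      open ≡-Reasoning
      above = ∑₂ (λ i j → inverted ρ i j * [ i < ρ j ])
      split : ∀ i j → inverted ρ i j
                    ≡ inverted ρ i j * 𝟙 (i ≟ᶠ ρ j) + inverted ρ i j * [ i < ρ j ] + inverted ρ i j * [ ρ j < i ]
      split i j = trans (sym (trans (cong (inverted ρ i j *_) ([<]-trichotomy i (ρ j))) (*-identityʳ _)))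
        (solve 4 (λ w x y z → w :* (x :+ y :+ z) := w :* x :+ w :* y :+ w :* z) refl
               (inverted ρ i j) (𝟙 (i ≟ᶠ ρ j)) [ i < ρ j ] [ ρ j < i ])
      decomposition : inversionCount ρ + drops ρ ≡ drops ρ + above + (drops ρ + above)
      decomposition = begin
        inversionCount ρ + drops ρ
          ≡⟨ cong (_+ drops ρ) (trans (∑₂-cong split) (∑₂-distrib-+₃ _ _ _)) ⟩
        ∑₂ (λ i j → inverted ρ i j * 𝟙 (i ≟ᶠ ρ j)) + above + ∑₂ (λ i j → inverted ρ i j * [ ρ j < i ]) + drops ρ
          ≡⟨ cong₂ (λ d b → d + above + b + drops ρ) inverted-on-graph inverted-below≡above ⟩
        drops ρ + above + above + drops ρ
          ≡⟨ solve 2 (λ d y → d :+ y :+ y :+ d := d :+ y :+ (d :+ y)) refl (drops ρ) above ⟩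
        drops ρ + above + (drops ρ + above) ∎

-- Squares in a finite abelian group

module FiniteAbelianGroup {n : ℕ} {mul : Op₂ (Fin n)} {unit : Fin n} {inverse : Op₁ (Fin n)}
                          (isAbelianGroup : IsAbelianGroup _≡_ mul unit inverse) where

  A : AbelianGroup 0ℓ 0ℓ
  A = record { isAbelianGroup = isAbelianGroup }

  open AbelianGroup A public using (_∙_; ε; _⁻¹; assoc; comm; identityˡ; identityʳ; inverseˡ; inverseʳ)
  open import Algebra.Properties.Group (AbelianGroup.group A) public
    using (ε⁻¹≈ε; ⁻¹-involutive; ⁻¹-injective; identityʳ-unique; ∙-cancelˡ; ∙-cancelʳ;
           x∙y⁻¹≈ε⇒x≈y; x≈y⇒x∙y⁻¹≈ε; \\-leftDividesˡ; \\-leftDividesʳ; //-rightDividesˡ; //-rightDividesʳ)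
  open import Algebra.Properties.AbelianGroup A public using (⁻¹-∙-comm; xyx⁻¹≈y)
  open import Algebra.Solver.CommutativeMonoid (AbelianGroup.commutativeMonoid A) public
    using (_⊕_; _⊜_) renaming (solve to ∙-solve)

  ∙-square : ∀ x y → (x ∙ y) ∙ (x ∙ y) ≡ (x ∙ x) ∙ (y ∙ y)
  ∙-square = ∙-solve 2 (λ x y → (x ⊕ y) ⊕ (x ⊕ y) ⊜ (x ⊕ x) ⊕ (y ⊕ y)) refl

  ⁻¹-∙ : ∀ x y → (x ∙ y) ⁻¹ ≡ x ⁻¹ ∙ y ⁻¹
  ⁻¹-∙ x y = sym (⁻¹-∙-comm x y)

  ⁻¹≡ε⇒≡ε : ∀ {x} → x ⁻¹ ≡ ε → x ≡ ε
  ⁻¹≡ε⇒≡ε x⁻¹≡ε = ⁻¹-injective (trans x⁻¹≡ε (sym ε⁻¹≈ε))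

  ⁻¹∙-chain : ∀ x y z → (x ⁻¹ ∙ y) ∙ (y ⁻¹ ∙ z) ≡ x ⁻¹ ∙ z
  ⁻¹∙-chain x y z = trans (∙-solve 4 (λ x' y y' z → (x' ⊕ y) ⊕ (y' ⊕ z) ⊜ y ⊕ (y' ⊕ (x' ⊕ z))) refl (x ⁻¹) y (y ⁻¹) z)
                          (\\-leftDividesˡ y (x ⁻¹ ∙ z))

  ∙⁻¹-chain : ∀ x y z → (x ∙ y ⁻¹) ∙ (y ∙ z ⁻¹) ≡ x ∙ z ⁻¹
  ∙⁻¹-chain x y z = trans (∙-solve 4 (λ x y' y z' → (x ⊕ y') ⊕ (y ⊕ z') ⊜ y ⊕ (y' ⊕ (x ⊕ z'))) refl x (y ⁻¹) y (z ⁻¹))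
                          (\\-leftDividesˡ y (x ∙ z ⁻¹))

  x⁻¹yx≡y : ∀ x y → x ⁻¹ ∙ y ∙ x ≡ y
  x⁻¹yx≡y x y = trans (comm (x ⁻¹ ∙ y) x) (\\-leftDividesˡ x y)

  x⁻¹yx⁻¹≡y[xx]⁻¹ : ∀ x y → x ⁻¹ ∙ y ∙ x ⁻¹ ≡ y ∙ (x ∙ x) ⁻¹
  x⁻¹yx⁻¹≡y[xx]⁻¹ x y = trans (∙-solve 2 (λ x' y → (x' ⊕ y) ⊕ x' ⊜ y ⊕ (x' ⊕ x')) refl (x ⁻¹) y)
                              (cong (y ∙_) (⁻¹-∙-comm x x))

  xy⁻¹x≡[xx]y⁻¹ : ∀ x y → x ∙ y ⁻¹ ∙ x ≡ (x ∙ x) ∙ y ⁻¹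
  xy⁻¹x≡[xx]y⁻¹ x y = ∙-solve 2 (λ x y' → (x ⊕ y') ⊕ x ⊜ (x ⊕ x) ⊕ y') refl x (y ⁻¹)

  IsSquare : Fin n → Set
  IsSquare x = ∃ λ b → b ∙ b ≡ x

  isSquare? : Decidable IsSquare
  isSquare? x = Finₚ.any? (λ b → b ∙ b ≟ᶠ x)

  ε-isSquare : IsSquare ε
  ε-isSquare = ε , identityʳ ε

  square-isSquare : ∀ x → IsSquare (x ∙ x)
  square-isSquare x = x , refl

  ∙-isSquare : ∀ {x y} → IsSquare x → IsSquare y → IsSquare (x ∙ y)
  ∙-isSquare (b , b²≡x) (d , d²≡y) = b ∙ d , trans (∙-square b d) (cong₂ _∙_ b²≡x d²≡y)

  ⁻¹-isSquare : ∀ {x} → IsSquare x → IsSquare (x ⁻¹)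
  ⁻¹-isSquare (b , b²≡x) = b ⁻¹ , trans (sym (⁻¹-∙ b b)) (cong _⁻¹ b²≡x)

  squareCount : ℕ
  squareCount = ∑[ s < n ] 𝟙 (isSquare? s)

  rootCount : Fin n → ℕ
  rootCount h = ∑[ c < n ] 𝟙 (h ≟ᶠ c ∙ c)

  rootCount-square : ∀ s → rootCount s ≡ 𝟙 (isSquare? s) * rootCount ε
  rootCount-square s with isSquare? s
  ... | no s-nonsquare = ∑-zero λ c → 𝟙-no (s ≟ᶠ c ∙ c) λ s≡c² → s-nonsquare (c , sym s≡c²)
  ... | yes (b , b²≡s) = begin
    rootCount s                                    ≡⟨ ∑-reindex {π = b ∙_} (\\-leftDividesˡ b) (\\-leftDividesʳ b) _ ⟨
    ∑[ c < n ] 𝟙 (s ≟ᶠ (b ∙ c) ∙ (b ∙ c))           ≡⟨ sum-cong-≗ (λ c → 𝟙-cong (s ≟ᶠ _) (ε ≟ᶠ c ∙ c) (to c) (from c)) ⟩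
    rootCount ε                                    ≡⟨ +-identityʳ (rootCount ε) ⟨
    1 * rootCount ε                                ∎
    where
    open ≡-Reasoning
    shifted : ∀ c → (b ∙ c) ∙ (b ∙ c) ≡ s ∙ (c ∙ c)
    shifted c = trans (∙-square b c) (cong (_∙ (c ∙ c)) b²≡s)
    to : ∀ c → s ≡ (b ∙ c) ∙ (b ∙ c) → ε ≡ c ∙ c
    to c s≡ = sym (identityʳ-unique s (c ∙ c) (sym (trans s≡ (shifted c))))
    from : ∀ c → ε ≡ c ∙ c → s ≡ (b ∙ c) ∙ (b ∙ c)
    from c ε≡c² = sym (trans (shifted c) (trans (cong (s ∙_) (sym ε≡c²)) (identityʳ s)))

  squareCount*rootCount≡size : squareCount * rootCount ε ≡ n
  squareCount*rootCount≡size = begin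
    squareCount * rootCount ε                    ≡⟨ *-distribʳ-sum (rootCount ε) (λ s → 𝟙 (isSquare? s)) ⟩
    ∑[ s < n ] (𝟙 (isSquare? s) * rootCount ε)   ≡⟨ sum-cong-≗ (λ s → sym (rootCount-square s)) ⟩
    ∑[ s < n ] rootCount s                       ≡⟨ ∑₂-transpose (λ s c → 𝟙 (s ≟ᶠ c ∙ c)) ⟩
    ∑[ c < n ] ∑[ s < n ] 𝟙 (s ≟ᶠ c ∙ c)         ≡⟨ sum-cong-≗ (λ c → ∑-𝟙≟ (c ∙ c)) ⟩
    ∑[ c < n ] 1                                 ≡⟨ ∑-ones n ⟩
    n                                            ∎
    where open ≡-Reasoning

  reflect : Fin n → Fin n → Fin n
  reflect h c = h ∙ c ⁻¹

  reflect-involutive : ∀ h c → reflect h (reflect h c) ≡ c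
  reflect-involutive h c = begin
    h ∙ (h ∙ c ⁻¹) ⁻¹       ≡⟨ cong (h ∙_) (trans (⁻¹-∙ h (c ⁻¹)) (cong (h ⁻¹ ∙_) (⁻¹-involutive c))) ⟩
    h ∙ (h ⁻¹ ∙ c)          ≡⟨ \\-leftDividesˡ h c ⟩
    c                       ∎
    where open ≡-Reasoning

  reflect-injective : ∀ h {c d} → reflect h c ≡ reflect h d → c ≡ d
  reflect-injective h {c} {d} eq =
    trans (sym (reflect-involutive h c)) (trans (cong (reflect h) eq) (reflect-involutive h d))

  fixedPoints-reflect : ∀ h → fixedPoints (reflect h) ≡ rootCount h
  fixedPoints-reflect h = sum-cong-≗ λ c → 𝟙-cong (reflect h c ≟ᶠ c) (h ≟ᶠ c ∙ c)
    (λ hc⁻¹≡c → trans (sym (//-rightDividesˡ c h)) (cong (_∙ c) hc⁻¹≡c))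
    (λ h≡c² → trans (cong (_∙ c ⁻¹) h≡c²) (//-rightDividesʳ c c))

  translation≡reflect∘reflect : ∀ g c → g ∙ c ≡ reflect g (reflect ε c)
  translation≡reflect∘reflect g c = cong (g ∙_) (sym (begin
    (ε ∙ c ⁻¹) ⁻¹   ≡⟨ cong _⁻¹ (identityˡ (c ⁻¹)) ⟩
    c ⁻¹ ⁻¹         ≡⟨ ⁻¹-involutive c ⟩
    c               ∎))
    where open ≡-Reasoning

  rootCount+drops+drops : ∀ h → rootCount h + drops (reflect h) + drops (reflect h) ≡ n
  rootCount+drops+drops h =
    trans (cong (λ k → k + drops (reflect h) + drops (reflect h)) (sym (fixedPoints-reflect h)))
          (fixedPoints+drops+drops (reflect h) (reflect-involutive h))

  rootCount-nonsquare : ∀ {h} → ¬ IsSquare h → rootCount h ≡ 0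
  rootCount-nonsquare {h} h-nonsquare =
    trans (rootCount-square h) (cong (_* rootCount ε) (𝟙-no (isSquare? h) h-nonsquare))

  1≤rootCount-ε : 1 ≤ rootCount ε
  1≤rootCount-ε = ≤-trans (≤-reflexive (sym (𝟙-yes (ε ≟ᶠ ε ∙ ε) (sym (identityʳ ε))))) (term≤∑ _ ε)

  1≤squareCount : 1 ≤ squareCount
  1≤squareCount = ≤-trans (≤-reflexive (sym (𝟙-yes (isSquare? ε) ε-isSquare))) (term≤∑ _ ε)

  module EvenTranslations (even-order : Even n) (translations-even : ∀ g → Even (inversionCount (g ∙_))) where

    2≤rootCount-ε : 2 ≤ rootCount ε
    2≤rootCount-ε =
      ∣⇒≤ ⦃ >-nonZero 1≤rootCount-ε ⦄ (Even-r+x+x (subst Even (sym (rootCount+drops+drops ε)) even-order))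

    ∃-nonsquare : ∃ λ g → ¬ IsSquare g
    ∃-nonsquare = Finₚ.¬∀⟶∃¬ n IsSquare isSquare? not-all-squares
      where
      not-all-squares : ¬ (∀ s → IsSquare s)
      not-all-squares all-squares = <-irrefl refl (begin-strict
        n                         <⟨ m<m*n n 2 ⦃ >-nonZero 1≤n ⦄ ≤-refl ⟩
        n * 2                     ≤⟨ *-monoʳ-≤ n 2≤rootCount-ε ⟩
        n * rootCount ε           ≡⟨ cong (_* rootCount ε) squareCount≡n ⟨
        squareCount * rootCount ε ≡⟨ squareCount*rootCount≡size ⟩
        n                         ∎)
        where
        open ≤-Reasoning
        squareCount≡n : squareCount ≡ n
        squareCount≡n = trans (sum-cong-≗ λ s → 𝟙-yes (isSquare? s) (all-squares s)) (∑-ones n)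
        1≤n : 1 ≤ n
        1≤n = subst (1 ≤_) squareCount≡n 1≤squareCount

    drops-parity : ∀ g → Even (drops (reflect ε) + drops (reflect g))
    drops-parity g = Even-cancel
      (subst Even (inversionCount-cong (translation≡reflect∘reflect g)) (translations-even g))
      (inversionCount-∘ (reflect g) (reflect ε) (reflect ε) (reflect-injective g)
                        (reflect-involutive ε) (reflect-involutive ε))
      (inversionCount-involution (reflect ε) (reflect-involutive ε))
      (inversionCount-involution (reflect g) (reflect-involutive g))

    4≤rootCount-ε : 4 ≤ rootCount ε
    4≤rootCount-ε = 4≤-from-parity balance (drops-parity g) 1≤rootCount-ε
      where
      g = proj₁ ∃-nonsquare
      g-nonsquare = proj₂ ∃-nonsquare
      balance : rootCount ε + drops (reflect ε) + drops (reflect ε) ≡ drops (reflect g) + drops (reflect g)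
      balance = trans (rootCount+drops+drops ε) (sym (trans
        (cong (λ k → k + drops (reflect g) + drops (reflect g)) (sym (rootCount-nonsquare g-nonsquare)))
        (rootCount+drops+drops g)))

    squareCount*4≤size : squareCount * 4 ≤ n
    squareCount*4≤size = ≤-trans (*-monoʳ-≤ squareCount 4≤rootCount-ε) (≤-reflexive squareCount*rootCount≡size)

    square-or-involution⇒involution : (∀ x → IsSquare x ⊎ x ∙ x ≡ ε) → ∀ y → y ∙ y ≡ ε
    square-or-involution⇒involution square-or-involution y with square-or-involution y
    ... | inj₂ y²≡ε     = y²≡ε
    ... | inj₁ y-square = begin
      y ∙ y                 ≡⟨ identityˡ (y ∙ y) ⟨
      ε ∙ (y ∙ y)           ≡⟨ cong (_∙ (y ∙ y)) (nonsquare-involution g-nonsquare) ⟨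
      (g ∙ g) ∙ (y ∙ y)     ≡⟨ ∙-square g y ⟨
      (g ∙ y) ∙ (g ∙ y)     ≡⟨ nonsquare-involution gy-nonsquare ⟩
      ε                     ∎
      where
      open ≡-Reasoning
      g = proj₁ ∃-nonsquare
      g-nonsquare = proj₂ ∃-nonsquare
      nonsquare-involution : ∀ {x} → ¬ IsSquare x → x ∙ x ≡ ε
      nonsquare-involution {x} x-nonsquare = [ flip contradiction x-nonsquare , id ]′ (square-or-involution x)
      gy-nonsquare : ¬ IsSquare (g ∙ y)
      gy-nonsquare gy-square =
        g-nonsquare (subst IsSquare (//-rightDividesʳ y g) (∙-isSquare gy-square (⁻¹-isSquare y-square)))

    ∃-nonsquare-of-order>2 : ¬ ElementaryAbelian _∙_ ε → ∃ λ a → ¬ IsSquare a × a ∙ a ≢ ε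
    ∃-nonsquare-of-order>2 not-elementary = map₂ (λ neither → neither ∘ inj₁ , neither ∘ inj₂)
      (Finₚ.¬∀⟶∃¬ n (λ x → IsSquare x ⊎ x ∙ x ≡ ε) (λ x → isSquare? x ⊎-dec (x ∙ x ≟ᶠ ε)) λ square-or-involution →
         not-elementary (2 , from-yes (prime? 2) , λ y →
           trans (cong (y ∙_) (identityʳ y)) (square-or-involution⇒involution square-or-involution y)))

    squareCount+squareCount<size : squareCount + squareCount < n
    squareCount+squareCount<size = <-≤-trans (k+k<k*4 1≤squareCount) squareCount*4≤size

    ∃-nonsquare-pair : ∀ a → ∃ λ c → ¬ IsSquare c × ¬ IsSquare (c ∙ a)
    ∃-nonsquare-pair a = map₂ (λ neither → neither ∘ inj₁ , neither ∘ inj₂)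
      (Finₚ.¬∀⟶∃¬ n (λ x → IsSquare x ⊎ IsSquare (x ∙ a)) (λ x → isSquare? x ⊎-dec isSquare? (x ∙ a)) not-covered)
      where
      not-covered : ¬ (∀ x → IsSquare x ⊎ IsSquare (x ∙ a))
      not-covered covered = <⇒≱ squareCount+squareCount<size (begin
        n                                                    ≡⟨ ∑-ones n ⟨
        ∑[ x < n ] 1                                         ≤⟨ ∑-mono-≤ (λ x → 1≤𝟙+𝟙 (isSquare? x) (isSquare? (x ∙ a)) (covered x)) ⟩
        ∑[ x < n ] (𝟙 (isSquare? x) + 𝟙 (isSquare? (x ∙ a))) ≡⟨ ∑-distrib-+ (λ x → 𝟙 (isSquare? x)) (λ x → 𝟙 (isSquare? (x ∙ a))) ⟩
        squareCount + ∑[ x < n ] 𝟙 (isSquare? (x ∙ a))       ≡⟨ cong (squareCount +_) shift ⟩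
        squareCount + squareCount                            ∎)
        where
        open ≤-Reasoning
        shift : ∑[ x < n ] 𝟙 (isSquare? (x ∙ a)) ≡ squareCount
        shift = ∑-reindex {π = _∙ a} (//-rightDividesˡ a) (//-rightDividesʳ a) (λ x → 𝟙 (isSquare? x))

-- The derangement graph of D(A)

module DerangementGraph {n : ℕ} {mul : Op₂ (Fin n)} {unit : Fin n} {inverse : Op₁ (Fin n)}
                        (isAbelianGroup : IsAbelianGroup _≡_ mul unit inverse) where

  open FiniteAbelianGroup isAbelianGroup
  open Dihedral _∙_ ε _⁻¹ renaming (_*_ to _⋆_)

  -- (z , false) is the rotation z ∈ A and (z , true) is the reflection z x.

  _≟ᴰ_ : (g h : D) → Dec (g ≡ h)
  _≟ᴰ_ = ≡-dec _≟ᶠ_ Boolₚ._≟_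

  rotation-derangement : ∀ {x} → x ≢ ε → Der (x , false)
  rotation-derangement {x} x≢ε (b , false) (inj₁ fixed) = x≢ε (trans (sym (x⁻¹yx≡y b x)) (cong proj₁ fixed))
  rotation-derangement {x} x≢ε (b , true)  (inj₁ fixed) = x≢ε (⁻¹≡ε⇒≡ε (trans (sym (xyx⁻¹≈y b (x ⁻¹))) (cong proj₁ fixed)))
  rotation-derangement _ (_ , false) (inj₂ ())
  rotation-derangement _ (_ , true)  (inj₂ ())

  reflection-derangement : ∀ {x} → ¬ IsSquare x → Der (x , true)
  reflection-derangement {x} x-nonsquare (b , false) (inj₂ fixed) =
    x-nonsquare (b , sym (x∙y⁻¹≈ε⇒x≈y x (b ∙ b) (trans (sym (x⁻¹yx⁻¹≡y[xx]⁻¹ b x)) (cong proj₁ fixed))))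
  reflection-derangement {x} x-nonsquare (b , true)  (inj₂ fixed) =
    x-nonsquare (b , x∙y⁻¹≈ε⇒x≈y (b ∙ b) x (trans (sym (xy⁻¹x≡[xx]y⁻¹ b x)) (cong proj₁ fixed)))
  reflection-derangement _ (_ , false) (inj₁ ())
  reflection-derangement _ (_ , true)  (inj₁ ())

  square-reflection-not-derangement : ∀ {x} → IsSquare x → ¬ Der (x , true)
  square-reflection-not-derangement {x} (b , b²≡x) derangement =
    derangement (b , false) (inj₂ (cong (_, true) (trans (x⁻¹yx⁻¹≡y[xx]⁻¹ b x) (x≈y⇒x∙y⁻¹≈ε (sym b²≡x)))))

  NonAdjacent : Pred D 0ℓ → D → D → Set
  NonAdjacent S g h = g ≢ h × ¬ S (inv g ⋆ h) × ¬ S (inv h ⋆ g)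

  NonAdjacent-sym : ∀ S {g h} → NonAdjacent S g h → NonAdjacent S h g
  NonAdjacent-sym _ (g≢h , gh∉S , hg∉S) = g≢h ∘ sym , hg∉S , gh∉S

  coset-quotient-derangement : ∀ x y s → (x , s) ≢ (y , s) → Der (inv (x , s) ⋆ (y , s))
  coset-quotient-derangement x y false x≢y = rotation-derangement λ x⁻¹y≡ε → x≢y (cong (_, false)
    (trans (sym (identityʳ x)) (trans (cong (x ∙_) (sym x⁻¹y≡ε)) (\\-leftDividesˡ x y))))
  coset-quotient-derangement x y true  x≢y = rotation-derangement λ xy⁻¹≡ε → x≢y (cong (_, true) (x∙y⁻¹≈ε⇒x≈y x y xy⁻¹≡ε))

  α-derangementGraph : IndependenceNumber Der 2
  α-derangementGraph = ((ε , false) ∷ (ε , true) ∷ [] , (witness ∷ []) ∷ [] ∷ [] , refl) , at-most-two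
    where
    witness : NonAdjacent Der (ε , false) (ε , true)
    witness = (λ ()) , square-reflection-not-derangement (subst IsSquare (sym (inverseˡ ε)) ε-isSquare)
                     , square-reflection-not-derangement (subst IsSquare (sym (inverseʳ ε)) ε-isSquare)
    same-coset : ∀ {x y s} → ¬ NonAdjacent Der (x , s) (y , s)
    same-coset {x} {y} {s} (x≢y , quotient-not-derangement , _) =
      quotient-not-derangement (coset-quotient-derangement x y s x≢y)
    pigeonhole : ∀ {x₁ x₂ x₃} s₁ s₂ s₃ → NonAdjacent Der (x₁ , s₁) (x₂ , s₂) →
      NonAdjacent Der (x₁ , s₁) (x₃ , s₃) → NonAdjacent Der (x₂ , s₂) (x₃ , s₃) → ⊥
    pigeonhole false false _     r₁₂ _   _   = same-coset r₁₂
    pigeonhole true  true  _     r₁₂ _   _   = same-coset r₁₂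
    pigeonhole false true  false _   r₁₃ _   = same-coset r₁₃
    pigeonhole true  false true  _   r₁₃ _   = same-coset r₁₃
    pigeonhole false true  true  _   _   r₂₃ = same-coset r₂₃
    pigeonhole true  false false _   _   r₂₃ = same-coset r₂₃
    at-most-two : ∀ L → Independent Der L → length L ≤ 2
    at-most-two []              _ = z≤n
    at-most-two (_ ∷ [])        _ = s≤s z≤n
    at-most-two (_ ∷ _ ∷ [])    _ = s≤s (s≤s z≤n)
    at-most-two ((_ , s₁) ∷ (_ , s₂) ∷ (_ , s₃) ∷ _) ((r₁₂ ∷ r₁₃ ∷ _) ∷ (r₂₃ ∷ _) ∷ _) =
      ⊥-elim (pigeonhole s₁ s₂ s₃ r₁₂ r₁₃ r₂₃)

  module RemovedDerangements (a c : Fin n) (a-nonsquare : ¬ IsSquare a) (a²≢ε : a ∙ a ≢ ε)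
                             (c-nonsquare : ¬ IsSquare c) (ca-nonsquare : ¬ IsSquare (c ∙ a)) where

    data Removed : Pred D 0ℓ where
      a-removed   : Removed (a , false)
      a⁻¹-removed : Removed (a ⁻¹ , false)
      cx-removed  : Removed (c , true)
      cax-removed : Removed (c ∙ a , true)

    removed? : ∀ g → Dec (Removed g)
    removed? g with g ≟ᴰ (a , false) | g ≟ᴰ (a ⁻¹ , false) | g ≟ᴰ (c , true) | g ≟ᴰ (c ∙ a , true)
    ... | yes refl | _        | _        | _        = yes a-removed
    ... | no _     | yes refl | _        | _        = yes a⁻¹-removed
    ... | no _     | no _     | yes refl | _        = yes cx-removed
    ... | no _     | no _     | no _     | yes refl = yes cax-removed
    ... | no g≢₁   | no g≢₂   | no g≢₃   | no g≢₄   =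
      no λ { a-removed → g≢₁ refl ; a⁻¹-removed → g≢₂ refl ; cx-removed → g≢₃ refl ; cax-removed → g≢₄ refl }

    a≢ε : a ≢ ε
    a≢ε a≡ε = a-nonsquare (subst IsSquare (sym a≡ε) ε-isSquare)

    removed-inverseClosed : InverseClosed Removed
    removed-inverseClosed _ a-removed   = a⁻¹-removed
    removed-inverseClosed _ a⁻¹-removed = subst Removed (cong (_, false) (sym (⁻¹-involutive a))) a-removed
    removed-inverseClosed _ cx-removed  = cx-removed
    removed-inverseClosed _ cax-removed = cax-removed

    removed⊆Der : Removed ⊆ Der
    removed⊆Der _ a-removed   = rotation-derangement a≢ε
    removed⊆Der _ a⁻¹-removed = rotation-derangement (a≢ε ∘ ⁻¹≡ε⇒≡ε)
    removed⊆Der _ cx-removed  = reflection-derangement c-nonsquare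
    removed⊆Der _ cax-removed = reflection-derangement ca-nonsquare

    S : Pred D 0ℓ
    S = Der ∖ Removed

    removed-derangement : ∀ {g} → Der g → ¬ S g → Removed g
    removed-derangement {g} derangement g∉S with removed? g
    ... | yes removed    = removed
    ... | no not-removed = contradiction (derangement , not-removed) g∉S

    ±a : Fin n → Set
    ±a z = z ≡ a ⊎ z ≡ a ⁻¹

    ±a-nonzero : ∀ {z} → ±a z → z ≢ ε
    ±a-nonzero (inj₁ refl) = a≢ε
    ±a-nonzero (inj₂ refl) = a≢ε ∘ ⁻¹≡ε⇒≡ε

    ±a-sum-free : ∀ {p q r} → ±a p → ±a q → ±a r → p ∙ q ≢ r
    ±a-sum-free (inj₁ refl) (inj₁ refl) (inj₁ refl) a²≡a   = a≢ε (identityʳ-unique a a a²≡a)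
    ±a-sum-free (inj₁ refl) (inj₁ refl) (inj₂ refl) a²≡a⁻¹ =
      a-nonsquare (a ∙ a , trans (cong (a ∙ a ∙_) a²≡a⁻¹) (//-rightDividesʳ a a))
    ±a-sum-free (inj₁ refl) (inj₂ refl) ±a-r aa⁻¹≡r = ±a-nonzero ±a-r (trans (sym aa⁻¹≡r) (inverseʳ a))
    ±a-sum-free (inj₂ refl) (inj₁ refl) ±a-r a⁻¹a≡r = ±a-nonzero ±a-r (trans (sym a⁻¹a≡r) (inverseˡ a))
    ±a-sum-free (inj₂ refl) (inj₂ refl) (inj₁ refl) a⁻²≡a  = a-nonsquare (a ⁻¹ , a⁻²≡a)
    ±a-sum-free (inj₂ refl) (inj₂ refl) (inj₂ refl) a⁻²≡a⁻¹ =
      ±a-nonzero (inj₂ refl) (identityʳ-unique (a ⁻¹) (a ⁻¹) a⁻²≡a⁻¹)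

    -- Exempt z holds exactly when the reflection z x is outside S.
    data Exempt : Fin n → Set where
      square : ∀ {z} → IsSquare z → Exempt z
      is-c   : Exempt c
      is-ca  : Exempt (c ∙ a)

    exempt-step : ∀ {u v} → Exempt u → Exempt v → v ≡ u ∙ a → u ≡ c
    exempt-step {u} (square u□) (square v□) v≡ua = ⊥-elim (a-nonsquare
      (subst IsSquare (trans (cong (u ⁻¹ ∙_) v≡ua) (\\-leftDividesʳ u a)) (∙-isSquare (⁻¹-isSquare u□) v□)))
    exempt-step {u} (square u□) is-c c≡ua = ⊥-elim (ca-nonsquare
      (subst IsSquare (trans (sym (assoc u a a)) (cong (_∙ a) (sym c≡ua))) (∙-isSquare u□ (square-isSquare a))))
    exempt-step (square _) is-ca ca≡ua = ∙-cancelʳ a _ c (sym ca≡ua)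
    exempt-step is-c  _ _ = refl
    exempt-step is-ca (square {v} v□) v≡caa = ⊥-elim (c-nonsquare (subst IsSquare v/a² (∙-isSquare v□ (square-isSquare (a ⁻¹)))))
      where
      open ≡-Reasoning
      v/a² : v ∙ (a ⁻¹ ∙ a ⁻¹) ≡ c
      v/a² = begin
        v ∙ (a ⁻¹ ∙ a ⁻¹)             ≡⟨ assoc v (a ⁻¹) (a ⁻¹) ⟨
        v ∙ a ⁻¹ ∙ a ⁻¹               ≡⟨ cong (λ w → w ∙ a ⁻¹ ∙ a ⁻¹) v≡caa ⟩
        c ∙ a ∙ a ∙ a ⁻¹ ∙ a ⁻¹       ≡⟨ cong (_∙ a ⁻¹) (//-rightDividesʳ a (c ∙ a)) ⟩
        c ∙ a ∙ a ⁻¹                  ≡⟨ //-rightDividesʳ a c ⟩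
        c                             ∎
    exempt-step is-ca is-c  c≡caa  = ⊥-elim (a²≢ε (identityʳ-unique c (a ∙ a) (trans (sym (assoc c a a)) (sym c≡caa))))
    exempt-step is-ca is-ca ca≡caa = ⊥-elim (a≢ε (identityʳ-unique (c ∙ a) a (sym ca≡caa)))

    removed-rotation : ∀ {z} → Removed (z , false) → ±a z
    removed-rotation a-removed   = inj₁ refl
    removed-rotation a⁻¹-removed = inj₂ refl

    removed-reflection : ∀ {z} → Removed (z , true) → Exempt z
    removed-reflection cx-removed  = is-c
    removed-reflection cax-removed = is-ca

    rotation-pair-±a : ∀ {x y} → NonAdjacent S (x , false) (y , false) → ±a (x ⁻¹ ∙ y)
    rotation-pair-±a {x} {y} (x≢y , quotient∉S , _) =
      removed-rotation (removed-derangement (coset-quotient-derangement x y false x≢y) quotient∉S)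

    reflection-pair-±a : ∀ {x y} → NonAdjacent S (x , true) (y , true) → ±a (x ∙ y ⁻¹)
    reflection-pair-±a {x} {y} (x≢y , quotient∉S , _) =
      removed-rotation (removed-derangement (coset-quotient-derangement x y true x≢y) quotient∉S)

    mixed-pair-exempt : ∀ {x y} → NonAdjacent S (x , false) (y , true) → Exempt (x ⁻¹ ∙ y)
    mixed-pair-exempt {x} {y} (_ , quotient∉S , _) with isSquare? (x ⁻¹ ∙ y)
    ... | yes quotient-square = square quotient-square
    ... | no  quotient-nonsquare = removed-reflection (removed-derangement (reflection-derangement quotient-nonsquare) quotient∉S)

    three-rotations : ∀ {x₁ x₂ x₃} → NonAdjacent S (x₁ , false) (x₂ , false) →
      NonAdjacent S (x₁ , false) (x₃ , false) → NonAdjacent S (x₂ , false) (x₃ , false) → ⊥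
    three-rotations {x₁} {x₂} {x₃} r₁₂ r₁₃ r₂₃ =
      ±a-sum-free (rotation-pair-±a r₁₂) (rotation-pair-±a r₂₃) (rotation-pair-±a r₁₃) (⁻¹∙-chain x₁ x₂ x₃)

    three-reflections : ∀ {x₁ x₂ x₃} → NonAdjacent S (x₁ , true) (x₂ , true) →
      NonAdjacent S (x₁ , true) (x₃ , true) → NonAdjacent S (x₂ , true) (x₃ , true) → ⊥
    three-reflections {x₁} {x₂} {x₃} r₁₂ r₁₃ r₂₃ =
      ±a-sum-free (reflection-pair-±a r₁₂) (reflection-pair-±a r₂₃) (reflection-pair-±a r₁₃) (∙⁻¹-chain x₁ x₂ x₃)

    -- Passing from x₁ to x₂ multiplies both quotients x₁⁻¹ yⱼ by a, so exempt-step makes both equal c.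
    parallel-steps : ∀ {x₁ x₂ y₁ y₂} → x₂ ≡ x₁ ∙ a ⁻¹ → y₁ ≢ y₂ →
      Exempt (x₁ ⁻¹ ∙ y₁) → Exempt (x₁ ⁻¹ ∙ y₂) → Exempt (x₂ ⁻¹ ∙ y₁) → Exempt (x₂ ⁻¹ ∙ y₂) → ⊥
    parallel-steps {x₁} {x₂} {y₁} {y₂} x₂≡x₁a⁻¹ y₁≢y₂ e₁₁ e₁₂ e₂₁ e₂₂ = y₁≢y₂ (∙-cancelˡ (x₁ ⁻¹) y₁ y₂
      (trans (exempt-step e₁₁ e₂₁ (shift y₁)) (sym (exempt-step e₁₂ e₂₂ (shift y₂)))))
      where
      open ≡-Reasoning
      shift : ∀ y → x₂ ⁻¹ ∙ y ≡ x₁ ⁻¹ ∙ y ∙ a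
      shift y = begin
        x₂ ⁻¹ ∙ y            ≡⟨ cong (λ x → x ⁻¹ ∙ y) x₂≡x₁a⁻¹ ⟩
        (x₁ ∙ a ⁻¹) ⁻¹ ∙ y   ≡⟨ cong (_∙ y) (trans (⁻¹-∙ x₁ (a ⁻¹)) (cong (x₁ ⁻¹ ∙_) (⁻¹-involutive a))) ⟩
        x₁ ⁻¹ ∙ a ∙ y        ≡⟨ ∙-solve 3 (λ x a y → (x ⊕ a) ⊕ y ⊜ (x ⊕ y) ⊕ a) refl (x₁ ⁻¹) a y ⟩
        x₁ ⁻¹ ∙ y ∙ a        ∎

    two-rotations-two-reflections : ∀ {x₁ x₂ y₁ y₂} →
      NonAdjacent S (x₁ , false) (x₂ , false) → NonAdjacent S (y₁ , true) (y₂ , true) →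
      NonAdjacent S (x₁ , false) (y₁ , true) → NonAdjacent S (x₁ , false) (y₂ , true) →
      NonAdjacent S (x₂ , false) (y₁ , true) → NonAdjacent S (x₂ , false) (y₂ , true) → ⊥
    two-rotations-two-reflections {x₁} {x₂} r₁₂ (y₁≢y₂ , _) r₁₁′ r₁₂′ r₂₁′ r₂₂′ with rotation-pair-±a r₁₂
    ... | inj₁ x₁⁻¹x₂≡a = parallel-steps
      (trans (sym (//-rightDividesʳ a x₁)) (cong (_∙ a ⁻¹) (trans (cong (x₁ ∙_) (sym x₁⁻¹x₂≡a)) (\\-leftDividesˡ x₁ x₂))))
      (y₁≢y₂ ∘ cong (_, true)) (mixed-pair-exempt r₂₁′) (mixed-pair-exempt r₂₂′) (mixed-pair-exempt r₁₁′) (mixed-pair-exempt r₁₂′)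
    ... | inj₂ x₁⁻¹x₂≡a⁻¹ = parallel-steps
      (trans (sym (\\-leftDividesˡ x₁ x₂)) (cong (x₁ ∙_) x₁⁻¹x₂≡a⁻¹))
      (y₁≢y₂ ∘ cong (_, true)) (mixed-pair-exempt r₁₁′) (mixed-pair-exempt r₁₂′) (mixed-pair-exempt r₂₁′) (mixed-pair-exempt r₂₂′)

    removed∉S : ∀ {g h} → g ≡ h → Removed h → ¬ S g
    removed∉S refl removed (_ , not-removed) = not-removed removed

    independent-ε-a-cax : Independent S ((ε , false) ∷ (a , false) ∷ (c ∙ a , true) ∷ [])
    independent-ε-a-cax =
      ( ( (λ ε≡a → a≢ε (sym (cong proj₁ ε≡a)))
        , removed∉S (cong (_, false) (trans (cong (_∙ a) ε⁻¹≈ε) (identityˡ a))) a-removed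
        , removed∉S (cong (_, false) (identityʳ (a ⁻¹))) a⁻¹-removed)
      ∷ ( (λ ())
        , removed∉S (cong (_, true) (trans (cong (_∙ (c ∙ a)) ε⁻¹≈ε) (identityˡ (c ∙ a)))) cax-removed
        , removed∉S (cong (_, true) (trans (cong (c ∙ a ∙_) ε⁻¹≈ε) (identityʳ (c ∙ a)))) cax-removed)
      ∷ [])
      ∷ (( (λ ())
         , removed∉S (cong (_, true) (trans (comm (a ⁻¹) (c ∙ a)) (//-rightDividesʳ a c))) cx-removed
         , removed∉S (cong (_, true) (//-rightDividesʳ a c)) cx-removed)
        ∷ [])
      ∷ [] ∷ []

    no-independent-quadruple : ∀ {x₁ x₂ x₃ x₄} s₁ s₂ s₃ s₄ →
      NonAdjacent S (x₁ , s₁) (x₂ , s₂) → NonAdjacent S (x₁ , s₁) (x₃ , s₃) → NonAdjacent S (x₁ , s₁) (x₄ , s₄) →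
      NonAdjacent S (x₂ , s₂) (x₃ , s₃) → NonAdjacent S (x₂ , s₂) (x₄ , s₄) → NonAdjacent S (x₃ , s₃) (x₄ , s₄) → ⊥
    no-independent-quadruple false false false _     r₁₂ r₁₃ r₁₄ r₂₃ r₂₄ r₃₄ = three-rotations r₁₂ r₁₃ r₂₃
    no-independent-quadruple false false true  false r₁₂ r₁₃ r₁₄ r₂₃ r₂₄ r₃₄ = three-rotations r₁₂ r₁₄ r₂₄
    no-independent-quadruple false false true  true  r₁₂ r₁₃ r₁₄ r₂₃ r₂₄ r₃₄ = two-rotations-two-reflections r₁₂ r₃₄ r₁₃ r₁₄ r₂₃ r₂₄
    no-independent-quadruple false true  false false r₁₂ r₁₃ r₁₄ r₂₃ r₂₄ r₃₄ = three-rotations r₁₃ r₁₄ r₃₄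
    no-independent-quadruple false true  false true  r₁₂ r₁₃ r₁₄ r₂₃ r₂₄ r₃₄ =
      two-rotations-two-reflections r₁₃ r₂₄ r₁₂ r₁₄ (NonAdjacent-sym S r₂₃) r₃₄
    no-independent-quadruple false true  true  false r₁₂ r₁₃ r₁₄ r₂₃ r₂₄ r₃₄ =
      two-rotations-two-reflections r₁₄ r₂₃ r₁₂ r₁₃ (NonAdjacent-sym S r₂₄) (NonAdjacent-sym S r₃₄)
    no-independent-quadruple false true  true  true  r₁₂ r₁₃ r₁₄ r₂₃ r₂₄ r₃₄ = three-reflections r₂₃ r₂₄ r₃₄
    no-independent-quadruple true  false false false r₁₂ r₁₃ r₁₄ r₂₃ r₂₄ r₃₄ = three-rotations r₂₃ r₂₄ r₃₄
    no-independent-quadruple true  false false true  r₁₂ r₁₃ r₁₄ r₂₃ r₂₄ r₃₄ =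
      two-rotations-two-reflections r₂₃ r₁₄ (NonAdjacent-sym S r₁₂) r₂₄ (NonAdjacent-sym S r₁₃) r₃₄
    no-independent-quadruple true  false true  false r₁₂ r₁₃ r₁₄ r₂₃ r₂₄ r₃₄ =
      two-rotations-two-reflections r₂₄ r₁₃ (NonAdjacent-sym S r₁₂) r₂₃ (NonAdjacent-sym S r₁₄) (NonAdjacent-sym S r₃₄)
    no-independent-quadruple true  false true  true  r₁₂ r₁₃ r₁₄ r₂₃ r₂₄ r₃₄ = three-reflections r₁₃ r₁₄ r₃₄
    no-independent-quadruple true  true  false false r₁₂ r₁₃ r₁₄ r₂₃ r₂₄ r₃₄ =
      two-rotations-two-reflections r₃₄ r₁₂ (NonAdjacent-sym S r₁₃) (NonAdjacent-sym S r₂₃) (NonAdjacent-sym S r₁₄) (NonAdjacent-sym S r₂₄)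
    no-independent-quadruple true  true  false true  r₁₂ r₁₃ r₁₄ r₂₃ r₂₄ r₃₄ = three-reflections r₁₂ r₁₄ r₂₄
    no-independent-quadruple true  true  true  _     r₁₂ r₁₃ r₁₄ r₂₃ r₂₄ r₃₄ = three-reflections r₁₂ r₁₃ r₂₃

    α-without-removed : IndependenceNumber S 3
    α-without-removed = ((ε , false) ∷ (a , false) ∷ (c ∙ a , true) ∷ [] , independent-ε-a-cax , refl) , at-most-three
      where
      at-most-three : ∀ L → Independent S L → length L ≤ 3
      at-most-three []                _ = z≤n
      at-most-three (_ ∷ [])          _ = s≤s z≤n
      at-most-three (_ ∷ _ ∷ [])      _ = s≤s (s≤s z≤n)
      at-most-three (_ ∷ _ ∷ _ ∷ [])  _ = s≤s (s≤s (s≤s z≤n))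
      at-most-three ((_ , s₁) ∷ (_ , s₂) ∷ (_ , s₃) ∷ (_ , s₄) ∷ _)
                    ((r₁₂ ∷ r₁₃ ∷ r₁₄ ∷ _) ∷ (r₂₃ ∷ r₂₄ ∷ _) ∷ (r₃₄ ∷ _) ∷ _) =
        ⊥-elim (no-independent-quadruple s₁ s₂ s₃ s₄ r₁₂ r₁₃ r₁₄ r₂₃ r₂₄ r₃₄)

proposition4p12 : (n : ℕ) (_∙_ : Fin n → Fin n → Fin n) (ε : Fin n) (_⁻¹ : Fin n → Fin n) →
    IsAbelianGroup _≡_ _∙_ ε _⁻¹ →
    2 ∣ n →
    ¬ ElementaryAbelian _∙_ ε →
    (∀ a → EvenPerm (Dihedral.cosetPerm _∙_ ε _⁻¹ (Dihedral.ι _∙_ ε _⁻¹ a))) →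
    Dihedral.IndependenceNumber _∙_ ε _⁻¹ (Dihedral.Der _∙_ ε _⁻¹) 2
    × Σ (Pred (Dihedral.D _∙_ ε _⁻¹) 0ℓ) (λ D →
        Dihedral.InverseClosed _∙_ ε _⁻¹ D
        × Dihedral._⊆_ _∙_ ε _⁻¹ D (Dihedral.Der _∙_ ε _⁻¹)
        × Dihedral.IndependenceNumber _∙_ ε _⁻¹ (Dihedral._∖_ _∙_ ε _⁻¹ (Dihedral.Der _∙_ ε _⁻¹) D) 3)
proposition4p12 _ _ _ _ isAbelianGroup even-order not-elementary ι-even =
  let a , a-nonsquare , a²≢ε          = ∃-nonsquare-of-order>2 not-elementary
      c , c-nonsquare , ca-nonsquare = ∃-nonsquare-pair a
      open RemovedDerangements a c a-nonsquare a²≢ε c-nonsquare ca-nonsquare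
  in α-derangementGraph , Removed , removed-inverseClosed , removed⊆Der , α-without-removed
  where
  open FiniteAbelianGroup isAbelianGroup
  open EvenTranslations even-order (λ g → subst Even (inversions≡inversionCount (g ∙_)) (ι-even g))
  open DerangementGraph isAbelianGroup
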